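{- There are no games $X,Y$ with $X$ of type $\mathcal Q$ satisfying any of the following: (i) $Y$ of type $\mathcal P$ and $X+Y$ of type $\mathcal N$; (ii) $Y$ of type $\mathcal P$ and $X+Y$ of type $\mathcal P$; (iii) $Y$ of type $\mathcal O$ and $X+Y$ of type $\mathcal P$; (iv) $Y$ of type $\mathcal P$ and $X+Y$ of type $\mathcal O$; (v) $Y$ of type $\mathcal N$ and $X+Y$ of type $\mathcal O$.
   Context: A (finite impartial) game is defined recursively as a finite set of games, its options; $0$ is the game with no options. Three players alternate moves cyclically; a move replaces the current game by one of its options, and the player who makes the last move wins. The disjunctive sum $G+H$ is the game whose options are all $G'+H$ ($G'$ an option of $G$) and all $G+H'$ ($H'$ an option of $H$). Types are defined recursively: $G$ is of type $\mathcal N$ iff it has some option of type $\mathcal P$; of type $\mathcal O$ iff it has at least one option and all its options are of type $\mathcal N$; of type $\mathcal P$ iff all its options are of type $\mathcal O$ (so $0$ is of type $\mathcal P$); of type $\mathcal Q$ otherwise. -}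

module Defs where

open import Data.List using (List; []; _∷_; _++_)
open import Data.Bool using (Bool; true; false; _∧_; _∨_; if_then_else_)

-- A finite impartial game: given by a finite list of options
-- (order and repetitions are irrelevant for everything below).
data Game : Set where
  mk : List Game → Game

zeroG : Game
zeroG = mk []

options : Game → List Game
options (mk gs) = gs

mutual
  infixl 6 _⊕_
  _⊕_ : Game → Game → Game
  g@(mk gs) ⊕ h@(mk hs) = mk (leftOpts gs h ++ rightOpts g hs)

  leftOpts : List Game → Game → List Game
  leftOpts [] h = []
  leftOpts (g ∷ gs) h = (g ⊕ h) ∷ leftOpts gs h

  rightOpts : Game → List Game → List Game
  rightOpts g [] = []
  rightOpts g (h ∷ hs) = (g ⊕ h) ∷ rightOpts g hs

-- The four types of three-player games.
data Type : Set where
  𝒩 𝒪 𝒫 𝒬 : Type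

isN isO isP : Type → Bool
isN 𝒩 = true
isN _ = false
isO 𝒪 = true
isO _ = false
isP 𝒫 = true
isP _ = false

anyL : (Type → Bool) → List Type → Bool
anyL p [] = false
anyL p (t ∷ ts) = p t ∨ anyL p ts

allL : (Type → Bool) → List Type → Bool
allL p [] = true
allL p (t ∷ ts) = p t ∧ allL p ts

nonEmpty : List Type → Bool
nonEmpty [] = false
nonEmpty (_ ∷ _) = true

-- Given the types of the options, the type of the game:
--   N iff some option is P;
--   O iff there is at least one option and all options are N;
--   P iff all options are O;
--   Q otherwise.
-- (These three conditions are mutually exclusive, so checking them in this
--  order is exactly the recursive definition.)
classify : List Type → Type
classify ts =
  if anyL isP ts then 𝒩
  else if nonEmpty ts ∧ allL isN ts then 𝒪
  else if allL isO ts then 𝒫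
  else 𝒬

mutual
  typeOf : Game → Type
  typeOf (mk gs) = classify (typesOf gs)

  typesOf : List Game → List Type
  typesOf [] = []
  typesOf (g ∷ gs) = typeOf g ∷ typesOf gs

-- A game of type 𝒫 is neutral up to 𝒬: if typeOf Y ≡ 𝒫 then typeOf (X ⊕ Y) is typeOf X
-- or 𝒬, so a 𝒬-game stays 𝒬, which excludes (i), (ii) and (iv). This is proved by
-- induction on X and Y together with four more exclusions, 𝒪+𝒪 ≠ 𝒫, 𝒩+𝒪 ≠ 𝒪,
-- 𝒬+𝒪 ≠ 𝒫 (iii) and 𝒬+𝒩 ≠ 𝒪 (v): each is refuted by one option of the sum, or by all
-- of them, whose type the induction hypothesis controls. Because the type of a game
-- depends only on the multiset of the types of its options, X ⊕ Y and Y ⊕ X have the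
-- same type, so these facts may be used with the summands in either order.

module Submission where

open import Defs
open import Data.Product using (_×_; _,_; proj₁; proj₂; ∃-syntax)
open import Data.Sum using (_⊎_; inj₁; inj₂)
open import Relation.Nullary using (¬_)
open import Relation.Binary.PropositionalEquality using (_≡_)

open import Algebra.Bundles using (CommutativeMonoid)
import Algebra.Properties.CommutativeSemigroup as CommutativeSemigroupProperties
open import Data.Bool using (Bool; true; false; _∨_; _∧_)
open import Data.Bool.Properties using (∨-commutativeMonoid; ∧-commutativeMonoid)
open import Data.List using (List; []; _∷_; map; _++_)
open import Data.List.Properties using (map-++; map-∘; map-cong-local)
open import Data.List.Membership.Propositional using (_∈_; find)
open import Data.List.Membership.Propositional.Properties
  using (∈-map⁺; ∈-map⁻; ∈-++⁺ˡ; ∈-++⁺ʳ; ∈-++⁻)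
open import Data.List.Relation.Unary.All as All using (All; []; _∷_; tabulate)
open import Data.List.Relation.Unary.All.Properties as All using ()
open import Data.List.Relation.Unary.Any as Any using (Any; here; there)
open import Data.List.Relation.Unary.Any.Properties as Any using ()
open import Data.List.Relation.Binary.Permutation.Propositional
  using (_↭_; refl; prep; swap; trans; module PermutationReasoning)
open import Data.List.Relation.Binary.Permutation.Propositional.Properties using (↭-length; ++-comm)
open import Function using (_∘_)
open import Relation.Nullary.Reflects using (Reflects; ofʸ; ofⁿ)
import Relation.Binary.PropositionalEquality as ≡
open ≡ using (_≢_; refl; cong; cong₂; subst; ≢-sym)

module _ {P : Type → Set} {p : Type → Bool} (p-reflects : ∀ t → Reflects (P t) (p t)) where

  anyL-true : ∀ ts → anyL p ts ≡ true → Any P ts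
  anyL-true (t ∷ ts) h with p t | p-reflects t
  ... | true  | ofʸ pt = here pt
  ... | false | ofⁿ _  = there (anyL-true ts h)

  anyL-false : ∀ ts → anyL p ts ≡ false → All (¬_ ∘ P) ts
  anyL-false []       _ = []
  anyL-false (t ∷ ts) h with p t | p-reflects t
  ... | false | ofⁿ ¬pt = ¬pt ∷ anyL-false ts h

  allL-true : ∀ ts → allL p ts ≡ true → All P ts
  allL-true []       _ = []
  allL-true (t ∷ ts) h with p t | p-reflects t
  ... | true | ofʸ pt = pt ∷ allL-true ts h

  allL-false : ∀ ts → allL p ts ≡ false → Any (¬_ ∘ P) ts
  allL-false (t ∷ ts) h with p t | p-reflects t
  ... | true  | ofʸ _   = there (allL-false ts h)
  ... | false | ofⁿ ¬pt = here ¬pt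

isN-reflects : ∀ t → Reflects (t ≡ 𝒩) (isN t)
isN-reflects 𝒩 = ofʸ refl
isN-reflects 𝒪 = ofⁿ λ ()
isN-reflects 𝒫 = ofⁿ λ ()
isN-reflects 𝒬 = ofⁿ λ ()

isO-reflects : ∀ t → Reflects (t ≡ 𝒪) (isO t)
isO-reflects 𝒩 = ofⁿ λ ()
isO-reflects 𝒪 = ofʸ refl
isO-reflects 𝒫 = ofⁿ λ ()
isO-reflects 𝒬 = ofⁿ λ ()

isP-reflects : ∀ t → Reflects (t ≡ 𝒫) (isP t)
isP-reflects 𝒩 = ofⁿ λ ()
isP-reflects 𝒪 = ofⁿ λ ()
isP-reflects 𝒫 = ofʸ refl
isP-reflects 𝒬 = ofⁿ λ ()

ClassifiedAs : List Type → Type → Set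
ClassifiedAs ts 𝒩 = Any (_≡ 𝒫) ts
ClassifiedAs ts 𝒪 = Any (_≡ 𝒩) ts × All (_≡ 𝒩) ts
ClassifiedAs ts 𝒫 = All (_≡ 𝒪) ts
-- "Otherwise" is stated positively, so that it can be used constructively.
ClassifiedAs ts 𝒬 = All (_≢ 𝒫) ts × Any (_≢ 𝒩) ts × Any (_≢ 𝒪) ts

classify-sound : ∀ ts → ClassifiedAs ts (classify ts)
classify-sound [] = []
classify-sound ts@(_ ∷ _) with anyL isP ts in p | allL isN ts in n | allL isO ts in o
... | true  | _     | _     = anyL-true isP-reflects ts p
... | false | false | true  = allL-true isO-reflects ts o
... | false | false | false =
  anyL-false isP-reflects ts p , allL-false isN-reflects ts n , allL-false isO-reflects ts o
... | false | true  | _     with allL-true isN-reflects ts n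
...   | all𝒩@(t≡𝒩 ∷ _) = here t≡𝒩 , all𝒩

anyL-↭ : ∀ p {ts us} → ts ↭ us → anyL p ts ≡ anyL p us
anyL-↭ p refl           = refl
anyL-↭ p (prep t q)     = cong (p t ∨_) (anyL-↭ p q)
anyL-↭ p (swap t u q)   = ≡.trans (x∙yz≈y∙xz (p t) (p u) _) (cong (λ b → p u ∨ (p t ∨ b)) (anyL-↭ p q))
  where open CommutativeSemigroupProperties (CommutativeMonoid.commutativeSemigroup ∨-commutativeMonoid)
anyL-↭ p (trans q r)    = ≡.trans (anyL-↭ p q) (anyL-↭ p r)

allL-↭ : ∀ p {ts us} → ts ↭ us → allL p ts ≡ allL p us
allL-↭ p refl           = refl
allL-↭ p (prep t q)     = cong (p t ∧_) (allL-↭ p q)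
allL-↭ p (swap t u q)   = ≡.trans (x∙yz≈y∙xz (p t) (p u) _) (cong (λ b → p u ∧ (p t ∧ b)) (allL-↭ p q))
  where open CommutativeSemigroupProperties (CommutativeMonoid.commutativeSemigroup ∧-commutativeMonoid)
allL-↭ p (trans q r)    = ≡.trans (allL-↭ p q) (allL-↭ p r)

nonEmpty-↭ : ∀ {ts us} → ts ↭ us → nonEmpty ts ≡ nonEmpty us
nonEmpty-↭ {[]}    {[]}    _ = refl
nonEmpty-↭ {_ ∷ _} {_ ∷ _} _ = refl
nonEmpty-↭ {[]}    {_ ∷ _} q with () ← ↭-length q
nonEmpty-↭ {_ ∷ _} {[]}    q with () ← ↭-length q

classify-↭ : ∀ {ts us} → ts ↭ us → classify ts ≡ classify us
classify-↭ q rewrite anyL-↭ isP q | nonEmpty-↭ q | allL-↭ isN q | allL-↭ isO q = refl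

typesOf≡map : ∀ gs → typesOf gs ≡ map typeOf gs
typesOf≡map []       = refl
typesOf≡map (g ∷ gs) = cong (typeOf g ∷_) (typesOf≡map gs)

optionTypes : Game → List Type
optionTypes G = map typeOf (options G)

typeOf≡classify : ∀ G → typeOf G ≡ classify (optionTypes G)
typeOf≡classify (mk gs) = cong classify (typesOf≡map gs)

mutual
  game-ind : (P : Game → Set) → (∀ G → (∀ {G'} → G' ∈ options G → P G') → P G) → ∀ G → P G
  game-ind P step (mk gs) = step (mk gs) (options-ind P step gs)

  options-ind : (P : Game → Set) → (∀ G → (∀ {G'} → G' ∈ options G → P G') → P G) →
                ∀ gs {G'} → G' ∈ gs → P G'
  options-ind P step (g ∷ gs) (here refl) = game-ind P step g
  options-ind P step (g ∷ gs) (there G'∈) = options-ind P step gs G'∈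

⊕-ind : (P : Game → Game → Set) →
        (∀ X Y → (∀ {X'} → X' ∈ options X → P X' Y) → (∀ {Y'} → Y' ∈ options Y → P X Y') → P X Y) →
        ∀ X Y → P X Y
⊕-ind P step = game-ind (λ X → ∀ Y → P X Y) λ X ihˡ →
               game-ind (P X) λ Y ihʳ → step X Y (λ X'∈ → ihˡ X'∈ Y) ihʳ

leftOpts≡map : ∀ gs h → leftOpts gs h ≡ map (_⊕ h) gs
leftOpts≡map []       h = refl
leftOpts≡map (g ∷ gs) h = cong (g ⊕ h ∷_) (leftOpts≡map gs h)

rightOpts≡map : ∀ g hs → rightOpts g hs ≡ map (g ⊕_) hs
rightOpts≡map g []       = refl
rightOpts≡map g (h ∷ hs) = cong (g ⊕ h ∷_) (rightOpts≡map g hs)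

options-⊕ : ∀ X Y → options (X ⊕ Y) ≡ map (_⊕ Y) (options X) ++ map (X ⊕_) (options Y)
options-⊕ (mk gs) (mk hs) = cong₂ _++_ (leftOpts≡map gs (mk hs)) (rightOpts≡map (mk gs) hs)

∈-⊕ˡ : ∀ X Y {X'} → X' ∈ options X → X' ⊕ Y ∈ options (X ⊕ Y)
∈-⊕ˡ X Y X'∈ = subst (_ ∈_) (≡.sym (options-⊕ X Y)) (∈-++⁺ˡ (∈-map⁺ (_⊕ Y) X'∈))

∈-⊕ʳ : ∀ X Y {Y'} → Y' ∈ options Y → X ⊕ Y' ∈ options (X ⊕ Y)
∈-⊕ʳ X Y Y'∈ = subst (_ ∈_) (≡.sym (options-⊕ X Y)) (∈-++⁺ʳ _ (∈-map⁺ (X ⊕_) Y'∈))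

optionTypes-⊕ : ∀ X Y → optionTypes (X ⊕ Y) ≡
  map (λ X' → typeOf (X' ⊕ Y)) (options X) ++ map (λ Y' → typeOf (X ⊕ Y')) (options Y)
optionTypes-⊕ X Y = begin
  map typeOf (options (X ⊕ Y))
    ≡⟨ cong (map typeOf) (options-⊕ X Y) ⟩
  map typeOf (map (_⊕ Y) (options X) ++ map (X ⊕_) (options Y))
    ≡⟨ map-++ typeOf (map (_⊕ Y) (options X)) (map (X ⊕_) (options Y)) ⟩
  map typeOf (map (_⊕ Y) (options X)) ++ map typeOf (map (X ⊕_) (options Y))
    ≡⟨ cong₂ _++_ (map-∘ (options X)) (map-∘ (options Y)) ⟨
  map (λ X' → typeOf (X' ⊕ Y)) (options X) ++ map (λ Y' → typeOf (X ⊕ Y')) (options Y)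
    ∎
  where open ≡.≡-Reasoning

optionTypes-⊕-↭ : ∀ X Y → (∀ {X'} → X' ∈ options X → typeOf (X' ⊕ Y) ≡ typeOf (Y ⊕ X'))
                        → (∀ {Y'} → Y' ∈ options Y → typeOf (X ⊕ Y') ≡ typeOf (Y' ⊕ X))
                        → optionTypes (X ⊕ Y) ↭ optionTypes (Y ⊕ X)
optionTypes-⊕-↭ X Y ihˡ ihʳ = begin
  optionTypes (X ⊕ Y)
    ≡⟨ optionTypes-⊕ X Y ⟩
  map (λ X' → typeOf (X' ⊕ Y)) (options X) ++ map (λ Y' → typeOf (X ⊕ Y')) (options Y)
    ↭⟨ ++-comm (map (λ X' → typeOf (X' ⊕ Y)) (options X))
               (map (λ Y' → typeOf (X ⊕ Y')) (options Y)) ⟩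
  map (λ Y' → typeOf (X ⊕ Y')) (options Y) ++ map (λ X' → typeOf (X' ⊕ Y)) (options X)
    ≡⟨ cong₂ _++_ (map-cong-local (tabulate ihʳ)) (map-cong-local (tabulate ihˡ)) ⟩
  map (λ Y' → typeOf (Y' ⊕ X)) (options Y) ++ map (λ X' → typeOf (Y ⊕ X')) (options X)
    ≡⟨ optionTypes-⊕ Y X ⟨
  optionTypes (Y ⊕ X)
    ∎
  where open PermutationReasoning

typeOf-⊕-comm : ∀ X Y → typeOf (X ⊕ Y) ≡ typeOf (Y ⊕ X)
typeOf-⊕-comm = ⊕-ind (λ X Y → typeOf (X ⊕ Y) ≡ typeOf (Y ⊕ X)) λ X Y ihˡ ihʳ → begin
  typeOf (X ⊕ Y)                  ≡⟨ typeOf≡classify (X ⊕ Y) ⟩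
  classify (optionTypes (X ⊕ Y))  ≡⟨ classify-↭ (optionTypes-⊕-↭ X Y ihˡ ihʳ) ⟩
  classify (optionTypes (Y ⊕ X))  ≡⟨ typeOf≡classify (Y ⊕ X) ⟨
  typeOf (Y ⊕ X)                  ∎
  where open ≡.≡-Reasoning

typeOf-sound : ∀ G → ClassifiedAs (optionTypes G) (typeOf G)
typeOf-sound G =
  subst (ClassifiedAs (optionTypes G)) (≡.sym (typeOf≡classify G)) (classify-sound (optionTypes G))

module _ (G : Game) where

  private
    spec : ∀ {c} → typeOf G ≡ c → ClassifiedAs (optionTypes G) c
    spec h = subst (ClassifiedAs (optionTypes G)) h (typeOf-sound G)

  𝒩⇒𝒫-option : typeOf G ≡ 𝒩 → ∃[ G' ] G' ∈ options G × typeOf G' ≡ 𝒫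
  𝒩⇒𝒫-option h = find (Any.map⁻ (spec h))

  𝒪⇒𝒩-option : typeOf G ≡ 𝒪 → ∃[ G' ] G' ∈ options G × typeOf G' ≡ 𝒩
  𝒪⇒𝒩-option h = find (Any.map⁻ (proj₁ (spec h)))

  𝒪⇒options-𝒩 : typeOf G ≡ 𝒪 → ∀ {G'} → G' ∈ options G → typeOf G' ≡ 𝒩
  𝒪⇒options-𝒩 h = All.lookup (All.map⁻ (proj₂ (spec h)))

  𝒫⇒options-𝒪 : typeOf G ≡ 𝒫 → ∀ {G'} → G' ∈ options G → typeOf G' ≡ 𝒪
  𝒫⇒options-𝒪 h = All.lookup (All.map⁻ (spec h))

  𝒬⇒options-≢𝒫 : typeOf G ≡ 𝒬 → ∀ {G'} → G' ∈ options G → typeOf G' ≢ 𝒫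
  𝒬⇒options-≢𝒫 h = All.lookup (All.map⁻ (proj₁ (spec h)))

  𝒬⇒option-≢𝒩 : typeOf G ≡ 𝒬 → ∃[ G' ] G' ∈ options G × typeOf G' ≢ 𝒩
  𝒬⇒option-≢𝒩 h = find (Any.map⁻ (proj₁ (proj₂ (spec h))))

  𝒬⇒option-≢𝒪 : typeOf G ≡ 𝒬 → ∃[ G' ] G' ∈ options G × typeOf G' ≢ 𝒪
  𝒬⇒option-≢𝒪 h = find (Any.map⁻ (proj₂ (proj₂ (spec h))))

∈-⊕⁻ : ∀ {Z} X Y → Z ∈ options (X ⊕ Y) →
       (∃[ X' ] X' ∈ options X × Z ≡ X' ⊕ Y) ⊎ (∃[ Y' ] Y' ∈ options Y × Z ≡ X ⊕ Y')
∈-⊕⁻ X Y Z∈ with ∈-++⁻ (map (_⊕ Y) (options X)) (subst (_ ∈_) (options-⊕ X Y) Z∈)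
... | inj₁ Z∈ˡ = inj₁ (∈-map⁻ (_⊕ Y) Z∈ˡ)
... | inj₂ Z∈ʳ = inj₂ (∈-map⁻ (X ⊕_) Z∈ʳ)

⊕-options-≢ : ∀ X Y {d} → (∀ {X'} → X' ∈ options X → typeOf (X' ⊕ Y) ≢ d) →
              (∀ {Y'} → Y' ∈ options Y → typeOf (X ⊕ Y') ≢ d) →
              ∀ {Z} → Z ∈ options (X ⊕ Y) → typeOf Z ≢ d
⊕-options-≢ X Y avoidˡ avoidʳ Z∈ with ∈-⊕⁻ X Y Z∈
... | inj₁ (_ , X'∈ , refl) = avoidˡ X'∈
... | inj₂ (_ , Y'∈ , refl) = avoidʳ Y'∈

≢𝒩-⊕ : ∀ X Y → (∀ {X'} → X' ∈ options X → typeOf (X' ⊕ Y) ≢ 𝒫) →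
       (∀ {Y'} → Y' ∈ options Y → typeOf (X ⊕ Y') ≢ 𝒫) → typeOf (X ⊕ Y) ≢ 𝒩
≢𝒩-⊕ X Y avoidˡ avoidʳ h =
  let _ , Z∈ , Z-𝒫 = 𝒩⇒𝒫-option (X ⊕ Y) h in ⊕-options-≢ X Y avoidˡ avoidʳ Z∈ Z-𝒫

≢𝒪-⊕ : ∀ X Y → (∀ {X'} → X' ∈ options X → typeOf (X' ⊕ Y) ≢ 𝒩) →
       (∀ {Y'} → Y' ∈ options Y → typeOf (X ⊕ Y') ≢ 𝒩) → typeOf (X ⊕ Y) ≢ 𝒪
≢𝒪-⊕ X Y avoidˡ avoidʳ h =
  let _ , Z∈ , Z-𝒩 = 𝒪⇒𝒩-option (X ⊕ Y) h in ⊕-options-≢ X Y avoidˡ avoidʳ Z∈ Z-𝒩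

-- ⊕𝒫-type-or-𝒬 says typeOf (X ⊕ Y) ∈ {a, 𝒬}. The five facts are exactly those the induction
-- step needs at options, so they are proved together.
record SumFacts (X Y : Game) : Set where
  field
    ⊕𝒫-type-or-𝒬 : ∀ {a c} → typeOf X ≡ a → typeOf Y ≡ 𝒫 → c ≢ a → c ≢ 𝒬 → typeOf (X ⊕ Y) ≢ c
    𝒪⊕𝒪≢𝒫       : typeOf X ≡ 𝒪 → typeOf Y ≡ 𝒪 → typeOf (X ⊕ Y) ≢ 𝒫
    𝒩⊕𝒪≢𝒪       : typeOf X ≡ 𝒩 → typeOf Y ≡ 𝒪 → typeOf (X ⊕ Y) ≢ 𝒪
    𝒬⊕𝒪≢𝒫       : typeOf X ≡ 𝒬 → typeOf Y ≡ 𝒪 → typeOf (X ⊕ Y) ≢ 𝒫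
    𝒬⊕𝒩≢𝒪       : typeOf X ≡ 𝒬 → typeOf Y ≡ 𝒩 → typeOf (X ⊕ Y) ≢ 𝒪

open SumFacts

module _ {X Y : Game}
         (ih-X'Y : ∀ {X'} → X' ∈ options X → SumFacts X' Y)
         (ih-YX' : ∀ {X'} → X' ∈ options X → SumFacts Y X')
         (ih-XY' : ∀ {Y'} → Y' ∈ options Y → SumFacts X Y')
         (ih-Y'X : ∀ {Y'} → Y' ∈ options Y → SumFacts Y' X) where

  sumFacts-step : SumFacts X Y
  ⊕𝒫-type-or-𝒬 sumFacts-step {c = 𝒬} _ _ _ c≢𝒬 _ = c≢𝒬 refl
  ⊕𝒫-type-or-𝒬 sumFacts-step {𝒩} {𝒩} _ _ c≢a _ _ = c≢a refl
  ⊕𝒫-type-or-𝒬 sumFacts-step {𝒪} {𝒪} _ _ c≢a _ _ = c≢a refl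
  ⊕𝒫-type-or-𝒬 sumFacts-step {𝒫} {𝒫} _ _ c≢a _ _ = c≢a refl
  ⊕𝒫-type-or-𝒬 sumFacts-step {𝒩} {𝒪} X-𝒩 Y-𝒫 _ _ h =
    let X' , X'∈ , X'-𝒫 = 𝒩⇒𝒫-option X X-𝒩 in
    ⊕𝒫-type-or-𝒬 (ih-X'Y X'∈) X'-𝒫 Y-𝒫 (λ ()) (λ ()) (𝒪⇒options-𝒩 (X ⊕ Y) h (∈-⊕ˡ X Y X'∈))
  ⊕𝒫-type-or-𝒬 sumFacts-step {𝒩} {𝒫} X-𝒩 Y-𝒫 _ _ h =
    let X' , X'∈ , X'-𝒫 = 𝒩⇒𝒫-option X X-𝒩 in
    ⊕𝒫-type-or-𝒬 (ih-X'Y X'∈) X'-𝒫 Y-𝒫 (λ ()) (λ ()) (𝒫⇒options-𝒪 (X ⊕ Y) h (∈-⊕ˡ X Y X'∈))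
  ⊕𝒫-type-or-𝒬 sumFacts-step {𝒪} {𝒩} X-𝒪 Y-𝒫 _ _ = ≢𝒩-⊕ X Y
    (λ X'∈ → ⊕𝒫-type-or-𝒬 (ih-X'Y X'∈) (𝒪⇒options-𝒩 X X-𝒪 X'∈) Y-𝒫 (λ ()) (λ ()))
    (λ Y'∈ → 𝒪⊕𝒪≢𝒫 (ih-XY' Y'∈) X-𝒪 (𝒫⇒options-𝒪 Y Y-𝒫 Y'∈))
  ⊕𝒫-type-or-𝒬 sumFacts-step {𝒪} {𝒫} X-𝒪 Y-𝒫 _ _ h =
    let X' , X'∈ , X'-𝒩 = 𝒪⇒𝒩-option X X-𝒪 in
    ⊕𝒫-type-or-𝒬 (ih-X'Y X'∈) X'-𝒩 Y-𝒫 (λ ()) (λ ()) (𝒫⇒options-𝒪 (X ⊕ Y) h (∈-⊕ˡ X Y X'∈))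
  ⊕𝒫-type-or-𝒬 sumFacts-step {𝒫} {𝒩} X-𝒫 Y-𝒫 _ _ = ≢𝒩-⊕ X Y
    (λ X'∈ → ⊕𝒫-type-or-𝒬 (ih-X'Y X'∈) (𝒫⇒options-𝒪 X X-𝒫 X'∈) Y-𝒫 (λ ()) (λ ()))
    (λ {Y'} Y'∈ → ⊕𝒫-type-or-𝒬 (ih-Y'X Y'∈) (𝒫⇒options-𝒪 Y Y-𝒫 Y'∈) X-𝒫 (λ ()) (λ ())
                   ∘ ≡.trans (typeOf-⊕-comm Y' X))
  ⊕𝒫-type-or-𝒬 sumFacts-step {𝒫} {𝒪} X-𝒫 Y-𝒫 _ _ = ≢𝒪-⊕ X Y
    (λ X'∈ → ⊕𝒫-type-or-𝒬 (ih-X'Y X'∈) (𝒫⇒options-𝒪 X X-𝒫 X'∈) Y-𝒫 (λ ()) (λ ()))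
    (λ {Y'} Y'∈ → ⊕𝒫-type-or-𝒬 (ih-Y'X Y'∈) (𝒫⇒options-𝒪 Y Y-𝒫 Y'∈) X-𝒫 (λ ()) (λ ())
                   ∘ ≡.trans (typeOf-⊕-comm Y' X))
  ⊕𝒫-type-or-𝒬 sumFacts-step {𝒬} {𝒩} X-𝒬 Y-𝒫 _ _ = ≢𝒩-⊕ X Y
    (λ X'∈ → ⊕𝒫-type-or-𝒬 (ih-X'Y X'∈) refl Y-𝒫 (≢-sym (𝒬⇒options-≢𝒫 X X-𝒬 X'∈)) (λ ()))
    (λ Y'∈ → 𝒬⊕𝒪≢𝒫 (ih-XY' Y'∈) X-𝒬 (𝒫⇒options-𝒪 Y Y-𝒫 Y'∈))
  ⊕𝒫-type-or-𝒬 sumFacts-step {𝒬} {𝒪} X-𝒬 Y-𝒫 _ _ h =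
    let X' , X'∈ , X'≢𝒩 = 𝒬⇒option-≢𝒩 X X-𝒬 in
    ⊕𝒫-type-or-𝒬 (ih-X'Y X'∈) refl Y-𝒫 (≢-sym X'≢𝒩) (λ ()) (𝒪⇒options-𝒩 (X ⊕ Y) h (∈-⊕ˡ X Y X'∈))
  ⊕𝒫-type-or-𝒬 sumFacts-step {𝒬} {𝒫} X-𝒬 Y-𝒫 _ _ h =
    let X' , X'∈ , X'≢𝒪 = 𝒬⇒option-≢𝒪 X X-𝒬 in
    ⊕𝒫-type-or-𝒬 (ih-X'Y X'∈) refl Y-𝒫 (≢-sym X'≢𝒪) (λ ()) (𝒫⇒options-𝒪 (X ⊕ Y) h (∈-⊕ˡ X Y X'∈))
  𝒪⊕𝒪≢𝒫 sumFacts-step X-𝒪 Y-𝒪 h =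
    let X' , X'∈ , X'-𝒩 = 𝒪⇒𝒩-option X X-𝒪 in
    𝒩⊕𝒪≢𝒪 (ih-X'Y X'∈) X'-𝒩 Y-𝒪 (𝒫⇒options-𝒪 (X ⊕ Y) h (∈-⊕ˡ X Y X'∈))
  𝒩⊕𝒪≢𝒪 sumFacts-step X-𝒩 Y-𝒪 h =
    let X' , X'∈ , X'-𝒫 = 𝒩⇒𝒫-option X X-𝒩 in
    ⊕𝒫-type-or-𝒬 (ih-YX' X'∈) Y-𝒪 X'-𝒫 (λ ()) (λ ())
      (≡.trans (typeOf-⊕-comm Y X') (𝒪⇒options-𝒩 (X ⊕ Y) h (∈-⊕ˡ X Y X'∈)))
  𝒬⊕𝒪≢𝒫 sumFacts-step X-𝒬 Y-𝒪 h =
    let Y' , Y'∈ , Y'-𝒩 = 𝒪⇒𝒩-option Y Y-𝒪 in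
    𝒬⊕𝒩≢𝒪 (ih-XY' Y'∈) X-𝒬 Y'-𝒩 (𝒫⇒options-𝒪 (X ⊕ Y) h (∈-⊕ʳ X Y Y'∈))
  𝒬⊕𝒩≢𝒪 sumFacts-step X-𝒬 Y-𝒩 h =
    let Y' , Y'∈ , Y'-𝒫 = 𝒩⇒𝒫-option Y Y-𝒩 in
    ⊕𝒫-type-or-𝒬 (ih-XY' Y'∈) X-𝒬 Y'-𝒫 (λ ()) (λ ()) (𝒪⇒options-𝒩 (X ⊕ Y) h (∈-⊕ʳ X Y Y'∈))

sumFacts : ∀ X Y → SumFacts X Y
-- The hypothesis is kept for both orders of the summands: options with a 𝒫-game on the
-- left are handled through typeOf-⊕-comm.
sumFacts X Y = proj₁ (⊕-ind (λ X Y → SumFacts X Y × SumFacts Y X) step X Y)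
  where
  step : ∀ X Y → (∀ {X'} → X' ∈ options X → SumFacts X' Y × SumFacts Y X') →
                 (∀ {Y'} → Y' ∈ options Y → SumFacts X Y' × SumFacts Y' X) →
                 SumFacts X Y × SumFacts Y X
  step X Y ihˡ ihʳ =
    sumFacts-step (proj₁ ∘ ihˡ) (proj₂ ∘ ihˡ) (proj₁ ∘ ihʳ) (proj₂ ∘ ihʳ) ,
    sumFacts-step (proj₂ ∘ ihʳ) (proj₁ ∘ ihʳ) (proj₂ ∘ ihˡ) (proj₁ ∘ ihˡ)

claim4 : (X Y : Game) → typeOf X ≡ 𝒬 →
    ¬ ( (typeOf Y ≡ 𝒫 × typeOf (X ⊕ Y) ≡ 𝒩)
      ⊎ (typeOf Y ≡ 𝒫 × typeOf (X ⊕ Y) ≡ 𝒫)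
      ⊎ (typeOf Y ≡ 𝒪 × typeOf (X ⊕ Y) ≡ 𝒫)
      ⊎ (typeOf Y ≡ 𝒫 × typeOf (X ⊕ Y) ≡ 𝒪)
      ⊎ (typeOf Y ≡ 𝒩 × typeOf (X ⊕ Y) ≡ 𝒪) )
claim4 X Y X-𝒬 (inj₁ (Y-𝒫 , h))                      = ⊕𝒫-type-or-𝒬 (sumFacts X Y) X-𝒬 Y-𝒫 (λ ()) (λ ()) h
claim4 X Y X-𝒬 (inj₂ (inj₁ (Y-𝒫 , h)))               = ⊕𝒫-type-or-𝒬 (sumFacts X Y) X-𝒬 Y-𝒫 (λ ()) (λ ()) h
claim4 X Y X-𝒬 (inj₂ (inj₂ (inj₁ (Y-𝒪 , h))))        = 𝒬⊕𝒪≢𝒫 (sumFacts X Y) X-𝒬 Y-𝒪 h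
claim4 X Y X-𝒬 (inj₂ (inj₂ (inj₂ (inj₁ (Y-𝒫 , h))))) = ⊕𝒫-type-or-𝒬 (sumFacts X Y) X-𝒬 Y-𝒫 (λ ()) (λ ()) h
claim4 X Y X-𝒬 (inj₂ (inj₂ (inj₂ (inj₂ (Y-𝒩 , h))))) = 𝒬⊕𝒩≢𝒪 (sumFacts X Y) X-𝒬 Y-𝒩 h
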